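{- Let $f$ and $g$ be proper liftings. Then their composition $g\circ f$ is also a proper lifting.
   Context: A Boolean function $f\colon\mathbb{F}_2^k\to\mathbb{F}_2$ induces, for every $n\geq k$, the map $F\colon\mathbb{F}_2^n\to\mathbb{F}_2^n$ with $F(x)_i=f(x_i,\dotsc,x_{i+k-1})$ (indices mod $n$). $f$ has diameter $k$ if it depends on both $x_1$ and $x_k$; it is a $(k,n)$-lifting if it has diameter $k$ and this $F$ is bijective; it is a proper lifting if it is a $(k,n)$-lifting for every $n\geq k$. If $f$ and $g$ have diameters $k_f$ and $k_g$, the composition $g\circ f$ is the Boolean function obtained from \[ x\mapsto g\bigl(f(x_1,\dotsc,x_{k_f}),f(x_2,\dotsc,x_{k_f+1}),\dotsc,f(x_{k_g},\dotsc,x_{k_f+k_g-1})\bigr) \] by shifting indices so that $x_1$ is the first variable on which it depends; its diameter $k$ is the distance from the first to the last variable it depends on plus one (so $k\leq k_f+k_g-1$), and for every $n$ its induced map on $\mathbb{F}_2^n$ is, up to a shift of coordinates, $G\circ F$. -}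

module Defs where

open import Data.Bool using (Bool; true; false; not)
open import Data.Nat using (ℕ; zero; suc; _+_; _∸_; _≤_; _%_)
open import Data.Fin using (Fin; toℕ; fromℕ)
open import Data.Vec using (Vec; []; _∷_; lookup; tabulate)
open import Data.Product using (Σ; _×_; ∃)
open import Data.Empty using (⊥)
open import Relation.Nullary using (¬_)
open import Relation.Binary.PropositionalEquality using (_≡_; _≢_)
open import Function.Definitions using (Bijective)

-- A Boolean function of k variables f : F₂ᵏ → F₂ (variables x₁..x_k are
-- the entries 0..k-1 of the vector).
BoolFun : ℕ → Set
BoolFun k = Vec Bool k → Bool

DependsOn : {k : ℕ} → BoolFun k → Fin k → Set
DependsOn {k} f i = Σ (Vec Bool k) λ x → Σ (Vec Bool k) λ y →
  (∀ j → j ≢ i → lookup x j ≡ lookup y j) × (f x ≢ f y)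

HasDiameter : (k : ℕ) → BoolFun k → Set
HasDiameter zero    f = ⊥
HasDiameter (suc m) f = DependsOn f Fin.zero × DependsOn f (fromℕ m)

-- lookup at a natural-number index, with default false out of range
-- (only ever used in range below).
lookupD : {m : ℕ} → Vec Bool m → ℕ → Bool
lookupD []       _       = false
lookupD (a ∷ _)  zero    = a
lookupD (_ ∷ xs) (suc i) = lookupD xs i

-- the induced map F : F₂ⁿ → F₂ⁿ, F(x)ᵢ = f(xᵢ,…,x_{i+k-1}), indices mod n
-- (stated for n = suc n', i.e. n ≥ 1).
induced : (k n : ℕ) → BoolFun k → Vec Bool (suc n) → Vec Bool (suc n)
induced k n f x = tabulate λ (i : Fin (suc n)) →
  f (tabulate λ (j : Fin k) → lookupD x ((toℕ i + toℕ j) % suc n))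

IsLifting : (k n : ℕ) → BoolFun k → Set
IsLifting k n f = HasDiameter k f × Bijective _≡_ _≡_ (induced k n f)

ProperLifting : (k : ℕ) → BoolFun k → Set
ProperLifting k f = HasDiameter k f ×
  (∀ n → k ≤ suc n → Bijective _≡_ _≡_ (induced k n f))

window : {m : ℕ} → Vec Bool m → (s k : ℕ) → Vec Bool k
window x s k = tabulate λ (t : Fin k) → lookupD x (s + toℕ t)

rawComp : (kf kg : ℕ) → BoolFun kf → BoolFun kg → BoolFun (kf ∸ 1 + kg)
rawComp kf kg f g x = g (tabulate λ (j : Fin kg) → f (window x (toℕ j) kf))

-- h (of diameter k) is the composition g ∘ f obtained from rawComp by
-- shifting indices by s so that x₁ is the first variable it depends on:
-- rawComp(x) = h(x_{s+1}, …, x_{s+k}) and h depends on its first and last variable.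
IsComposition : (kf kg : ℕ) → BoolFun kf → BoolFun kg →
                (k : ℕ) → BoolFun k → ℕ → Set
IsComposition kf kg f g k h s =
  HasDiameter k h × (s + k ≤ kf ∸ 1 + kg) ×
  (∀ x → rawComp kf kg f g x ≡ h (window x s k))

-- Identify F₂ⁿ with the n-periodic configurations ℕ → F₂. The induced map of f is then
-- the cellular automaton with local rule f, and composing automata composes local rules,
-- so the induced map of g ∘ f is G ∘ F up to a rotation by the shift. A proper lifting is
-- bijective for every n, not only for n ≥ k: F on F₂ⁿ is F on F₂ᵐ, for a multiple m ≥ k
-- of n, restricted to the fixed points of the rotation by n, which commutes with F. Hence
-- G ∘ F, and with it the induced map of g ∘ f, is bijective for every n. Finally g ∘ f is
-- well defined because the untrimmed composition is not constant (G ∘ F is injective on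
-- F₂¹), so it has a first and a last essential variable and ignores all others.

module Submission where

open import Defs
open import Data.Bool using (Bool; true; false)
import Data.Bool.Properties as Bool
open import Data.Nat using (ℕ; zero; suc; _+_; _*_; _∸_; _≤_; _<_; _%_; _/_; NonZero; z≤n; s≤s)
open import Data.Nat.Properties
open import Data.Nat.DivMod using (m≡m%n+[m/n]*n; [m+n]%n≡m%n; m%n<n; m<n⇒m%n≡m)
open import Data.Fin as Fin using (Fin; toℕ; fromℕ)
open import Data.Fin.Properties using (toℕ<n; toℕ-injective; toℕ-fromℕ; any?; all?)
  renaming (suc-injective to Fin-suc-injective)
open import Data.Fin.Subset.Properties using (anySubset?)
open import Data.Vec using (Vec; []; _∷_; lookup; tabulate)
open import Data.Vec.Properties using (tabulate-cong; tabulate∘lookup; lookup∘tabulate)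
open import Data.Product using (Σ; _×_; _,_; proj₁; proj₂; ∃)
open import Function using (_∘_)
open import Level using (Level)
open import Function.Definitions using (Bijective; Injective; Surjective)
import Function.Construct.Composition as Composition
open import Relation.Binary.PropositionalEquality
open import Relation.Nullary using (yes; no; contradiction)
open import Relation.Nullary.Decidable using (¬?; _×-dec_; _→-dec_)
open import Relation.Unary using (Pred; Decidable)

private variable
  k m n L : ℕ

module _ {A B : Set} {F : A → A} {G : B → B} {E : A → B} {ρ : B → B} where

  -- F is G restricted to the image of E, which is the set of fixed points of ρ.
  restriction-bijective :
    Injective _≡_ _≡_ E → (∀ x → G (E x) ≡ E (F x)) →
    (∀ y → G (ρ y) ≡ ρ (G y)) → (∀ x → ρ (E x) ≡ E x) → (∀ y → ρ y ≡ y → ∃ λ x → E x ≡ y) →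
    Bijective _≡_ _≡_ G → Bijective _≡_ _≡_ F
  restriction-bijective E-inj GE≡EF Gρ≡ρG ρE≡E fixed⇒image (G-inj , G-surj) = F-inj , F-surj
    where
    open ≡-Reasoning
    F-inj : Injective _≡_ _≡_ F
    F-inj {x} {x′} Fx≡Fx′ = E-inj (G-inj (begin
      G (E x)  ≡⟨ GE≡EF x ⟩
      E (F x)  ≡⟨ cong E Fx≡Fx′ ⟩
      E (F x′) ≡⟨ GE≡EF x′ ⟨
      G (E x′) ∎))
    F-surj : Surjective _≡_ _≡_ F
    F-surj z = x , λ { refl → E-inj (begin
        E (F x) ≡⟨ GE≡EF x ⟨
        G (E x) ≡⟨ cong G Ex≡y ⟩
        G y     ≡⟨ Gy≡Ez ⟩
        E z     ∎) }
      where
      y : B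
      y = proj₁ (G-surj (E z))
      Gy≡Ez : G y ≡ E z
      Gy≡Ez = proj₂ (G-surj (E z)) refl
      ρy≡y : ρ y ≡ y
      ρy≡y = G-inj (begin
        G (ρ y) ≡⟨ Gρ≡ρG y ⟩
        ρ (G y) ≡⟨ cong ρ Gy≡Ez ⟩
        ρ (E z) ≡⟨ ρE≡E z ⟩
        E z     ≡⟨ Gy≡Ez ⟨
        G y     ∎)
      x : A
      x = proj₁ (fixed⇒image y ρy≡y)
      Ex≡y : E x ≡ y
      Ex≡y = proj₂ (fixed⇒image y ρy≡y)

module _ {A B C : Set} {σ : B → C} {H : A → B} {K : A → C} where

  injective∘-bijective⇒bijective :
    Injective _≡_ _≡_ σ → (∀ x → σ (H x) ≡ K x) → Bijective _≡_ _≡_ K → Bijective _≡_ _≡_ H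
  injective∘-bijective⇒bijective σ-inj σH≡K (K-inj , K-surj) = H-inj , H-surj
    where
    H-inj : Injective _≡_ _≡_ H
    H-inj {x} {x′} Hx≡Hx′ = K-inj (trans (sym (σH≡K x)) (trans (cong σ Hx≡Hx′) (σH≡K x′)))
    H-surj : Surjective _≡_ _≡_ H
    H-surj z = proj₁ (K-surj (σ z)) , λ { refl → σ-inj (trans (σH≡K _) (proj₂ (K-surj (σ z)) refl)) }

lookupD-tabulate : (φ : ℕ → Bool) {i : ℕ} → i < m → lookupD (tabulate {n = m} (φ ∘ toℕ)) i ≡ φ i
lookupD-tabulate φ {zero}  (s≤s _)   = refl
lookupD-tabulate φ {suc i} (s≤s i<m) = lookupD-tabulate (φ ∘ suc) i<m

lookupD-toℕ : (x : Vec Bool m) (i : Fin m) → lookupD x (toℕ i) ≡ lookup x i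
lookupD-toℕ (_ ∷ _) Fin.zero    = refl
lookupD-toℕ (_ ∷ x) (Fin.suc i) = lookupD-toℕ x i

Periodic : ℕ → (ℕ → Bool) → Set
Periodic p u = ∀ j → u (p + j) ≡ u j

periodic-multiple : ∀ {p u} → Periodic p u → ∀ q → Periodic (q * p) u
periodic-multiple             per zero    j = refl
periodic-multiple {p} {u} per (suc q) j = begin
  u (p + q * p + j)   ≡⟨ cong u (+-assoc p (q * p) j) ⟩
  u (p + (q * p + j)) ≡⟨ per (q * p + j) ⟩
  u (q * p + j)       ≡⟨ periodic-multiple per q j ⟩
  u j                 ∎
  where open ≡-Reasoning

periodic-mod : ∀ {p u} .{{_ : NonZero p}} → Periodic p u → ∀ j → u (j % p) ≡ u j
periodic-mod {p} {u} per j = begin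
  u (j % p)             ≡⟨ periodic-multiple per (j / p) (j % p) ⟨
  u (j / p * p + j % p) ≡⟨ cong u (+-comm (j / p * p) (j % p)) ⟩
  u (j % p + j / p * p) ≡⟨ cong u (m≡m%n+[m/n]*n j p) ⟨
  u j                   ∎
  where open ≡-Reasoning

periodic-shift : ∀ {p u} → Periodic p u → ∀ q → Periodic p (λ j → u (q + j))
periodic-shift {p} {u} per q j = trans (cong u q+[p+j]≡p+[q+j]) (per (q + j))
  where
  q+[p+j]≡p+[q+j] : q + (p + j) ≡ p + (q + j)
  q+[p+j]≡p+[q+j] = trans (sym (+-assoc q p j)) (trans (cong (_+ j) (+-comm q p)) (+-assoc p q j))

extend : Vec Bool (suc n) → ℕ → Bool
extend {n} x j = lookupD x (j % suc n)

restrict : (ℕ → Bool) → Vec Bool (suc n)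
restrict u = tabulate (u ∘ toℕ)

extend-periodic : (x : Vec Bool (suc n)) → Periodic (suc n) (extend x)
extend-periodic {n} x j =
  cong (lookupD x) (trans (cong (_% suc n) (+-comm (suc n) j)) ([m+n]%n≡m%n j (suc n)))

extend-restrict : ∀ {u} → Periodic (suc n) u → ∀ j → extend {n} (restrict u) j ≡ u j
extend-restrict {n} {u} per j = trans (lookupD-tabulate u (m%n<n j (suc n))) (periodic-mod per j)

restrict-extend : (x : Vec Bool (suc n)) → restrict (extend x) ≡ x
restrict-extend x = trans
  (tabulate-cong λ t → trans (cong (lookupD x) (m<n⇒m%n≡m (toℕ<n t))) (lookupD-toℕ x t))
  (tabulate∘lookup x)

restrict-cong : ∀ {u v} → (∀ j → u j ≡ v j) → restrict {n} u ≡ restrict v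
restrict-cong u≗v = tabulate-cong (u≗v ∘ toℕ)

slice : (ℕ → Bool) → ℕ → (m : ℕ) → Vec Bool m
slice u j m = tabulate λ t → u (j + toℕ t)

-- induced k n f x is definitionally restrict (cellular f (extend x)).
cellular : BoolFun k → (ℕ → Bool) → ℕ → Bool
cellular {k} f u j = f (slice u j k)

cellular-cong : (f : BoolFun k) {u v : ℕ → Bool} → (∀ j → u j ≡ v j) →
  ∀ j → cellular f u j ≡ cellular f v j
cellular-cong f u≗v j = cong f (tabulate-cong λ t → u≗v (j + toℕ t))

cellular-shift : (f : BoolFun k) (u : ℕ → Bool) (p j : ℕ) →
  cellular f (λ i → u (p + i)) j ≡ cellular f u (p + j)
cellular-shift f u p j = cong f (tabulate-cong λ t → cong u (sym (+-assoc p j (toℕ t))))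

cellular-periodic : (f : BoolFun k) {p : ℕ} {u : ℕ → Bool} → Periodic p u → Periodic p (cellular f u)
cellular-periodic f {p} {u} per j = trans (sym (cellular-shift f u p j)) (cellular-cong f per j)

extend-induced : (f : BoolFun k) (x : Vec Bool (suc n)) →
  ∀ j → extend (induced k n f x) j ≡ cellular f (extend x) j
extend-induced {n = n} f x = extend-restrict (cellular-periodic f {suc n} (extend-periodic x))

rotate : ℕ → Vec Bool (suc n) → Vec Bool (suc n)
rotate p x = restrict λ j → extend x (p + j)

extend-rotate : (p : ℕ) (x : Vec Bool (suc n)) → ∀ j → extend (rotate p x) j ≡ extend x (p + j)
extend-rotate p x = extend-restrict (periodic-shift (extend-periodic x) p)

induced-rotate : (f : BoolFun k) (p : ℕ) (x : Vec Bool (suc n)) →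
  induced k n f (rotate p x) ≡ rotate p (induced k n f x)
induced-rotate f p x = begin
  restrict (cellular f (extend (rotate p x)))    ≡⟨ restrict-cong (cellular-cong f (extend-rotate p x)) ⟩
  restrict (cellular f (λ j → extend x (p + j))) ≡⟨ restrict-cong (cellular-shift f (extend x) p) ⟩
  restrict (λ j → cellular f (extend x) (p + j)) ≡⟨ restrict-cong (λ j → extend-induced f x (p + j)) ⟨
  rotate p (induced _ _ f x)                     ∎
  where open ≡-Reasoning

rotate-inverse : (p : ℕ) (x : Vec Bool (suc n)) → rotate (p * n) (rotate p x) ≡ x
rotate-inverse {n} p x = begin
  rotate (p * n) (rotate p x)                  ≡⟨ restrict-cong (λ j → extend-rotate p x (p * n + j)) ⟩
  restrict (λ j → extend x (p + (p * n + j)))  ≡⟨ restrict-cong (λ j → cong (extend x) (p+[pn+j]≡p[1+n]+j j)) ⟩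
  restrict (λ j → extend x (p * suc n + j))    ≡⟨ restrict-cong (periodic-multiple (extend-periodic x) p) ⟩
  restrict (extend x)                          ≡⟨ restrict-extend x ⟩
  x                                            ∎
  where
  open ≡-Reasoning
  p+[pn+j]≡p[1+n]+j : ∀ j → p + (p * n + j) ≡ p * suc n + j
  p+[pn+j]≡p[1+n]+j j = trans (sym (+-assoc p (p * n) j)) (cong (_+ j) (sym (*-suc p n)))

rotate-injective : (p : ℕ) → Injective _≡_ _≡_ (rotate {n} p)
rotate-injective p {x} {y} eq =
  trans (sym (rotate-inverse p x)) (trans (cong (rotate (p * _)) eq) (rotate-inverse p y))

proper-lifting-bijective : {f : BoolFun k} → ProperLifting k f → ∀ n → Bijective _≡_ _≡_ (induced k n f)
proper-lifting-bijective {k} {f} (_ , bijective) n =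
  restriction-bijective {E = repeat} {ρ = rotate (suc n)}
    repeat-injective induced-repeat (induced-rotate f (suc n)) rotate-repeat rotation-fixed⇒repeat
    (bijective M (≤-trans (n≤1+n k) (m≤m*n (suc k) (suc n))))
  where
  open ≡-Reasoning
  -- suc M ≡ suc k * suc n: a ring length that is ≥ k and a multiple of suc n.
  M : ℕ
  M = n + k * suc n
  repeat : Vec Bool (suc n) → Vec Bool (suc M)
  repeat x = restrict (extend x)
  extend-repeat : ∀ x j → extend (repeat x) j ≡ extend x j
  extend-repeat x = extend-restrict (periodic-multiple {suc n} (extend-periodic x) (suc k))
  repeat-injective : Injective _≡_ _≡_ repeat
  repeat-injective {x} {y} eq = begin
    x                            ≡⟨ restrict-extend x ⟨
    restrict (extend x)          ≡⟨ restrict-cong (extend-repeat x) ⟨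
    restrict (extend (repeat x)) ≡⟨ cong (restrict ∘ extend) eq ⟩
    restrict (extend (repeat y)) ≡⟨ restrict-cong (extend-repeat y) ⟩
    restrict (extend y)          ≡⟨ restrict-extend y ⟩
    y                            ∎
  induced-repeat : ∀ x → induced k M f (repeat x) ≡ repeat (induced k n f x)
  induced-repeat x = begin
    restrict (cellular f (extend (repeat x))) ≡⟨ restrict-cong (cellular-cong f (extend-repeat x)) ⟩
    restrict (cellular f (extend x))          ≡⟨ restrict-cong (extend-induced f x) ⟨
    repeat (induced k n f x)                  ∎
  rotate-repeat : ∀ x → rotate (suc n) (repeat x) ≡ repeat x
  rotate-repeat x = begin
    restrict (λ j → extend (repeat x) (suc n + j)) ≡⟨ restrict-cong (λ j → extend-repeat x (suc n + j)) ⟩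
    restrict (λ j → extend x (suc n + j))          ≡⟨ restrict-cong (extend-periodic x) ⟩
    repeat x                                       ∎
  rotation-fixed⇒repeat : ∀ y → rotate (suc n) y ≡ y → ∃ λ x → repeat x ≡ y
  rotation-fixed⇒repeat y ρy≡y = restrict (extend y) , (begin
    restrict (extend (restrict {n} (extend y))) ≡⟨ restrict-cong (extend-restrict y-periodic) ⟩
    restrict (extend y)                         ≡⟨ restrict-extend y ⟩
    y                                           ∎)
    where
    y-periodic : Periodic (suc n) (extend y)
    y-periodic j = trans (sym (extend-rotate (suc n) y j)) (cong (λ v → extend v j) ρy≡y)

window-slice : (u : ℕ → Bool) (j : ℕ) {s : ℕ} → s + k ≤ L → window (slice u j L) s k ≡ slice u (j + s) k
window-slice {L = L} u j {s} s+k≤L = tabulate-cong λ t → begin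
  lookupD (slice u j L) (s + toℕ t)
    ≡⟨ lookupD-tabulate (λ i → u (j + i)) (<-≤-trans (+-monoʳ-< s (toℕ<n t)) s+k≤L) ⟩
  u (j + (s + toℕ t)) ≡⟨ cong u (+-assoc j s (toℕ t)) ⟨
  u (j + s + toℕ t)   ∎
  where open ≡-Reasoning

module _ {a kg : ℕ} (f : BoolFun (suc a)) (g : BoolFun kg) where

  cellular-rawComp : (u : ℕ → Bool) →
    ∀ j → cellular g (cellular f u) j ≡ cellular (rawComp (suc a) kg f g) u j
  cellular-rawComp u j = cong g (tabulate-cong λ i → cong f (sym (window-slice u j (fits i))))
    where
    fits : (i : Fin kg) → toℕ i + suc a ≤ a + kg
    fits i = begin
      toℕ i + suc a   ≡⟨ +-suc (toℕ i) a ⟩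
      suc (toℕ i) + a ≤⟨ +-monoˡ-≤ a (toℕ<n i) ⟩
      kg + a          ≡⟨ +-comm kg a ⟩
      a + kg          ∎
      where open ≤-Reasoning

  induced-rawComp : (x : Vec Bool (suc n)) →
    induced kg n g (induced (suc a) n f x) ≡ induced (a + kg) n (rawComp (suc a) kg f g) x
  induced-rawComp x = trans (restrict-cong (cellular-cong g (extend-induced f x)))
                            (restrict-cong (cellular-rawComp (extend x)))

-- IsComposition kf kg f g is IsTrimming (rawComp kf kg f g).
IsTrimming : BoolFun L → (k : ℕ) → BoolFun k → ℕ → Set
IsTrimming {L} r k h s = HasDiameter k h × s + k ≤ L × (∀ x → r x ≡ h (window x s k))

module _ {r : BoolFun L} {h : BoolFun k} {s : ℕ}
         (s+k≤L : s + k ≤ L) (r≡h : ∀ x → r x ≡ h (window x s k)) where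

  cellular-trimming : (u : ℕ → Bool) → ∀ j → cellular r u j ≡ cellular h u (s + j)
  cellular-trimming u j = begin
    r (slice u j L)              ≡⟨ r≡h (slice u j L) ⟩
    h (window (slice u j L) s k) ≡⟨ cong h (window-slice u j s+k≤L) ⟩
    h (slice u (j + s) k)        ≡⟨ cong (λ i → h (slice u i k)) (+-comm j s) ⟩
    h (slice u (s + j) k)        ∎
    where open ≡-Reasoning

  induced-trimming : (x : Vec Bool (suc n)) → rotate s (induced k n h x) ≡ induced L n r x
  induced-trimming x = trans (restrict-cong (λ j → extend-induced h x (s + j)))
                             (restrict-cong (λ j → sym (cellular-trimming (extend x) j)))

composition-proper : {a kg k s : ℕ} {f : BoolFun (suc a)} {g : BoolFun kg} {h : BoolFun k} →
  ProperLifting (suc a) f → ProperLifting kg g → IsTrimming (rawComp (suc a) kg f g) k h s → ProperLifting k h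
composition-proper {s = s} {f} {g} {h} f-proper g-proper (h-diameter , s+k≤L , r≡h) =
  h-diameter , λ n _ → injective∘-bijective⇒bijective (rotate-injective {n} s)
    (λ x → trans (induced-trimming {h = h} {s} s+k≤L r≡h x) (sym (induced-rawComp f g x)))
    (Composition.bijective _≡_ _≡_ _≡_ (proper-lifting-bijective f-proper n) (proper-lifting-bijective g-proper n))

dependsOn? : (r : BoolFun L) → Decidable (DependsOn r)
dependsOn? r i =
  anySubset? λ x → anySubset? λ y →
    all? (λ j → ¬? (j Fin.≟ i) →-dec lookup x j Bool.≟ lookup y j) ×-dec ¬? (r x Bool.≟ r y)

dependsOn-∷ : (r : BoolFun (suc L)) (b : Bool) {i : Fin L} →
  DependsOn (r ∘ (b ∷_)) i → DependsOn r (Fin.suc i)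
dependsOn-∷ r b (x , y , agree , rx≢ry) = b ∷ x , b ∷ y , agree′ , rx≢ry
  where
  agree′ : ∀ j → j ≢ Fin.suc _ → lookup (b ∷ x) j ≡ lookup (b ∷ y) j
  agree′ Fin.zero    _   = refl
  agree′ (Fin.suc j) j≢i = agree j (j≢i ∘ cong Fin.suc)

agree-on-dependencies : (r : BoolFun L) {x y : Vec Bool L} →
  (∀ i → DependsOn r i → lookup x i ≡ lookup y i) → r x ≡ r y
agree-on-dependencies r {[]}    {[]}    _     = refl
agree-on-dependencies r {a ∷ x} {b ∷ y} agree =
  trans head-irrelevant (agree-on-dependencies (r ∘ (b ∷_)) (λ i → agree (Fin.suc i) ∘ dependsOn-∷ r b))
  where
  head-irrelevant : r (a ∷ x) ≡ r (b ∷ x)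
  head-irrelevant with r (a ∷ x) Bool.≟ r (b ∷ x)
  ... | yes eq = eq
  ... | no neq = cong (λ c → r (c ∷ x)) (agree Fin.zero (a ∷ x , b ∷ x , same-tail , neq))
    where
    same-tail : ∀ j → j ≢ Fin.zero → lookup (a ∷ x) j ≡ lookup (b ∷ x) j
    same-tail Fin.zero    0≢0 = contradiction refl 0≢0
    same-tail (Fin.suc j) _   = refl

module _ {ℓ : Level} where

  least : {P : Pred (Fin L) ℓ} → Decidable P → ∃ P → ∃ λ i₀ → P i₀ × ∀ i → P i → toℕ i₀ ≤ toℕ i
  least P? (Fin.zero , P0) = Fin.zero , P0 , λ _ _ → z≤n
  least P? (Fin.suc i , Pi) with P? Fin.zero
  ... | yes P0 = Fin.zero , P0 , λ _ _ → z≤n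
  ... | no ¬P0 with least (P? ∘ Fin.suc) (i , Pi)
  ...   | i₀ , Pi₀ , minimal = Fin.suc i₀ , Pi₀ , λ where
          Fin.zero    P0 → contradiction P0 ¬P0
          (Fin.suc j) Pj → s≤s (minimal j Pj)

  greatest : {P : Pred (Fin L) ℓ} → Decidable P → ∃ P → ∃ λ i₁ → P i₁ × ∀ i → P i → toℕ i ≤ toℕ i₁
  greatest {L = suc L} P? (i , Pi) with any? (P? ∘ Fin.suc)
  ... | yes ∃P∘suc with greatest (P? ∘ Fin.suc) ∃P∘suc
  ...   | i₁ , Pi₁ , maximal = Fin.suc i₁ , Pi₁ , λ where
          Fin.zero    _  → z≤n
          (Fin.suc j) Pj → s≤s (maximal j Pj)
  greatest P? (Fin.zero , P0)  | no ¬∃P∘suc = Fin.zero , P0 , λ where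
          Fin.zero    _  → z≤n
          (Fin.suc j) Pj → contradiction (j , Pj) ¬∃P∘suc
  greatest P? (Fin.suc i , Pi) | no ¬∃P∘suc = contradiction (i , Pi) ¬∃P∘suc

lookupD-agree : (x y : Vec Bool m) (i₀ : Fin m) → (∀ i → i ≢ i₀ → lookup x i ≡ lookup y i) →
  ∀ a → a ≢ toℕ i₀ → lookupD x a ≡ lookupD y a
lookupD-agree (_ ∷ _) (_ ∷ _) i₀ agree zero 0≢i₀ = agree Fin.zero (0≢i₀ ∘ cong toℕ)
lookupD-agree (_ ∷ x) (_ ∷ y) Fin.zero agree (suc a) _ = cong (λ v → lookupD v a) x≡y
  where
  x≡y : x ≡ y
  x≡y = trans (sym (tabulate∘lookup x))
              (trans (tabulate-cong λ j → agree (Fin.suc j) λ ()) (tabulate∘lookup y))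
lookupD-agree (_ ∷ x) (_ ∷ y) (Fin.suc i₀) agree (suc a) a≢i₀ =
  lookupD-agree x y i₀ (λ i i≢i₀ → agree (Fin.suc i) (i≢i₀ ∘ Fin-suc-injective)) a (a≢i₀ ∘ cong suc)

dependsOn-window : {r : BoolFun L} {h : BoolFun k} {s : ℕ} → (∀ x → r x ≡ h (window x s k)) →
  (i : Fin L) (j : Fin k) → toℕ i ≡ s + toℕ j → DependsOn r i → DependsOn h j
dependsOn-window {k = k} {s = s} r≡h i j i≡s+j (x , y , agree , rx≢ry) =
  window x s k , window y s k , agree-window ,
  λ hx≡hy → rx≢ry (trans (r≡h x) (trans hx≡hy (sym (r≡h y))))
  where
  open ≡-Reasoning
  agree-window : ∀ j′ → j′ ≢ j → lookup (window x s k) j′ ≡ lookup (window y s k) j′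
  agree-window j′ j′≢j = begin
    lookup (window x s k) j′ ≡⟨ lookup∘tabulate _ j′ ⟩
    lookupD x (s + toℕ j′)   ≡⟨ lookupD-agree x y i agree (s + toℕ j′) s+j′≢i ⟩
    lookupD y (s + toℕ j′)   ≡⟨ lookup∘tabulate _ j′ ⟨
    lookup (window y s k) j′ ∎
    where
    s+j′≢i : s + toℕ j′ ≢ toℕ i
    s+j′≢i eq = j′≢j (toℕ-injective (+-cancelˡ-≡ s _ _ (trans eq i≡s+j)))

-- Positions outside the window are filled with junk (w₀ before it, false after it); r ignores them.
trimmed : BoolFun L → (s k : ℕ) → BoolFun k
trimmed r s k w = r (tabulate λ t → lookupD w (toℕ t ∸ s))

window-determines : (r : BoolFun L) {s e : ℕ} → (∀ i → DependsOn r i → s ≤ toℕ i × toℕ i ≤ e) →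
  ∀ x → r x ≡ trimmed r s (suc (e ∸ s)) (window x s (suc (e ∸ s)))
window-determines r {s} {e} bounds x = agree-on-dependencies r λ i Di → sym (begin
  lookup (tabulate λ t → lookupD (window x s width) (toℕ t ∸ s)) i ≡⟨ lookup∘tabulate _ i ⟩
  lookupD (window x s width) (toℕ i ∸ s)
    ≡⟨ lookupD-tabulate (λ a → lookupD x (s + a)) (s≤s (∸-monoˡ-≤ s (proj₂ (bounds i Di)))) ⟩
  lookupD x (s + (toℕ i ∸ s)) ≡⟨ cong (lookupD x) (m+[n∸m]≡n (proj₁ (bounds i Di))) ⟩
  lookupD x (toℕ i)           ≡⟨ lookupD-toℕ x i ⟩
  lookup x i                  ∎)
  where
  open ≡-Reasoning
  width : ℕ
  width = suc (e ∸ s)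

trim-between : (r : BoolFun L) {i₀ i₁ : Fin L} → DependsOn r i₀ → DependsOn r i₁ →
  (∀ i → DependsOn r i → toℕ i₀ ≤ toℕ i × toℕ i ≤ toℕ i₁) →
  IsTrimming r (suc (toℕ i₁ ∸ toℕ i₀)) (trimmed r (toℕ i₀) (suc (toℕ i₁ ∸ toℕ i₀))) (toℕ i₀)
trim-between {L} r {i₀} {i₁} Di₀ Di₁ bounds =
  (dependsOn-window r≡h i₀ Fin.zero (sym (+-identityʳ s)) Di₀ ,
   dependsOn-window r≡h i₁ (fromℕ (e ∸ s)) e≡s+last Di₁) ,
  s+k≤L , r≡h
  where
  s e : ℕ
  s = toℕ i₀
  e = toℕ i₁
  s+[e∸s]≡e : s + (e ∸ s) ≡ e
  s+[e∸s]≡e = m+[n∸m]≡n (proj₁ (bounds i₁ Di₁))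
  r≡h : ∀ x → r x ≡ trimmed r s (suc (e ∸ s)) (window x s (suc (e ∸ s)))
  r≡h = window-determines r bounds
  e≡s+last : e ≡ s + toℕ (fromℕ (e ∸ s))
  e≡s+last = trans (sym s+[e∸s]≡e) (cong (s +_) (sym (toℕ-fromℕ (e ∸ s))))
  s+k≤L : s + suc (e ∸ s) ≤ L
  s+k≤L = subst (_≤ L) (sym (trans (+-suc s (e ∸ s)) (cong suc s+[e∸s]≡e))) (toℕ<n i₁)

trim : (r : BoolFun L) → ∃ (DependsOn r) → Σ ℕ λ k → Σ (BoolFun k) λ h → Σ ℕ λ s → IsTrimming r k h s
trim r dependency with least (dependsOn? r) dependency | greatest (dependsOn? r) dependency
... | i₀ , Di₀ , i₀-least | i₁ , Di₁ , i₁-greatest =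
  _ , _ , _ , trim-between r Di₀ Di₁ λ i Di → i₀-least i Di , i₁-greatest i Di

rawComp-depends : {a kg : ℕ} {f : BoolFun (suc a)} {g : BoolFun kg} →
  ProperLifting (suc a) f → ProperLifting kg g → ∃ (DependsOn (rawComp (suc a) kg f g))
rawComp-depends {a} {kg} {f} {g} f-proper g-proper with any? (dependsOn? (rawComp (suc a) kg f g))
... | yes dependency = dependency
... | no independent = contradiction (G∘F-injective {false ∷ []} {true ∷ []} G∘F-constant) λ ()
  where
  r : BoolFun (a + kg)
  r = rawComp (suc a) kg f g
  G∘F : Vec Bool 1 → Vec Bool 1
  G∘F = induced kg 0 g ∘ induced (suc a) 0 f
  G∘F-injective : Injective _≡_ _≡_ G∘F
  G∘F-injective = proj₁
    (Composition.bijective _≡_ _≡_ _≡_ (proper-lifting-bijective f-proper 0) (proper-lifting-bijective g-proper 0))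
  r-constant : ∀ x y → r x ≡ r y
  r-constant x y = agree-on-dependencies r {x} {y} λ i Di → contradiction (i , Di) independent
  cellular-constant : ∀ u v j → cellular r u j ≡ cellular r v j
  cellular-constant u v j = r-constant (slice u j (a + kg)) (slice v j (a + kg))
  G∘F-constant : G∘F (false ∷ []) ≡ G∘F (true ∷ [])
  G∘F-constant = begin
    G∘F (false ∷ [])                   ≡⟨ induced-rawComp f g (false ∷ []) ⟩
    induced (a + kg) 0 r (false ∷ [])
      ≡⟨ restrict-cong (cellular-constant (extend (false ∷ [])) (extend (true ∷ []))) ⟩
    induced (a + kg) 0 r (true ∷ [])   ≡⟨ induced-rawComp f g (true ∷ []) ⟨
    G∘F (true ∷ [])                    ∎
    where open ≡-Reasoning

mainTheorem4 : (kf kg : ℕ) (f : BoolFun kf) (g : BoolFun kg) →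
    ProperLifting kf f → ProperLifting kg g →
    Σ ℕ (λ k → Σ (BoolFun k) λ h → Σ ℕ λ s → IsComposition kf kg f g k h s)
    × ((k : ℕ) (h : BoolFun k) (s : ℕ) →
       IsComposition kf kg f g k h s → ProperLifting k h)
mainTheorem4 zero    kg f g (() , _) g-proper
mainTheorem4 (suc a) kg f g f-proper g-proper =
  trim (rawComp (suc a) kg f g) (rawComp-depends f-proper g-proper) ,
  λ k h s → composition-proper f-proper g-proper
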